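{- Let $P=(G,V_A,V_B)$ be a position of the Maker-Maker domination game and let $x,y$ be two unclaimed vertices. Assume that for both $t\in\{A,B\}$, $N[x]\setminus N[V_t]\subseteq N[y]\setminus N[V_t]$, where $N[V_t]=\bigcup_{v\in V_t}N[v]$. Then there exists an optimal strategy (for playing from $P$) in which $y$ is claimed before $x$.
   Context: Maker-Maker domination game: on a finite simple graph $G$, Alice and Bob alternately claim previously unclaimed vertices; the first player whose claimed vertices form a dominating set of $G$ wins; if all vertices are claimed and nobody dominates, it is a draw. $N[x]$ is the closed neighbourhood of $x$. A position is $P=(G,V_A,V_B)$ with $V_A\cap V_B=\emptyset$ the vertices already claimed by Alice and Bob respectively; vertices outside $V_A\cup V_B$ are unclaimed. Outcomes: Alice either has a winning strategy (outcome $\mathcal{A}$) or not (outcome $\mathcal{D}$); an optimal strategy is one achieving the outcome for the corresponding player. -}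

module Defs where

open import Data.Nat using (ℕ; suc)
open import Data.Fin using (Fin)
open import Data.Fin.Subset using (Subset; _∈_; _∉_; _∪_; _∩_; ⁅_⁆; ∣_∣; Empty)
open import Data.Bool using (Bool; true; false)
open import Data.Product using (_×_; ∃; _,_)
open import Data.Sum using (_⊎_)
open import Data.Unit using (⊤)
open import Relation.Nullary using (¬_)
open import Relation.Binary.PropositionalEquality using (_≡_)

record Graph (n : ℕ) : Set where
  field
    adj    : Fin n → Fin n → Bool
    sym    : ∀ u v → adj u v ≡ adj v u
    irrefl : ∀ u → adj u u ≡ false
open Graph public

Edge : ∀ {n} → Graph n → Fin n → Fin n → Set
Edge G u v = adj G u v ≡ true

InN : ∀ {n} → Graph n → Fin n → Fin n → Set
InN G x u = u ≡ x ⊎ Edge G x u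

InNS : ∀ {n} → Graph n → Subset n → Fin n → Set
InNS G S u = ∃ λ v → v ∈ S × InN G v u

Dominating : ∀ {n} → Graph n → Subset n → Set
Dominating G S = ∀ u → InNS G S u

NbhdSub : ∀ {n} → Graph n → Fin n → Fin n → Subset n → Set
NbhdSub G x y V = ∀ u → (InN G x u × ¬ InNS G V u) → (InN G y u × ¬ InNS G V u)

data Player : Set where
  alice bob : Player

Unclaimed : ∀ {n} → Subset n → Subset n → Fin n → Set
Unclaimed VA VB v = v ∉ VA × v ∉ VB

ToMove : ∀ {n} → Subset n → Subset n → Player → Set
ToMove VA VB alice = ∣ VA ∣ ≡ ∣ VB ∣
ToMove VA VB bob   = ∣ VA ∣ ≡ suc ∣ VB ∣

-- A rule restricting which moves one player may make: Rule VA VB v says that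
-- claiming v is allowed in position (VA, VB).
Rule : ℕ → Set₁
Rule n = Subset n → Subset n → Fin n → Set

Free : ∀ {n} → Rule n
Free _ _ _ = ⊤

-- "y is claimed before x": never claim x while y is still unclaimed.
YBeforeX : ∀ {n} → Fin n → Fin n → Rule n
YBeforeX x y VA VB v = ¬ (v ≡ x × Unclaimed VA VB y)

-- AliceWins G R p VA VB : from position (G,VA,VB) with p to move, Alice has a
-- winning strategy all of whose moves satisfy R.  (A player wins as soon as her
-- claimed set dominates; a full board with no dominator is a draw.)
data AliceWins {n} (G : Graph n) (R : Rule n) : Player → Subset n → Subset n → Set where
  aMove : ∀ {VA VB} (v : Fin n) → Unclaimed VA VB v → R VA VB v →
          (Dominating G (VA ∪ ⁅ v ⁆) ⊎ AliceWins G R bob (VA ∪ ⁅ v ⁆) VB) →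
          AliceWins G R alice VA VB
  bMove : ∀ {VA VB} → (∃ λ v → Unclaimed VA VB v) →
          (∀ v → Unclaimed VA VB v →
             ¬ Dominating G (VB ∪ ⁅ v ⁆) × AliceWins G R alice VA (VB ∪ ⁅ v ⁆)) →
          AliceWins G R bob VA VB

-- BobHolds G R p VA VB : from this position Bob has a strategy, all of whose
-- moves satisfy R, guaranteeing that Alice does not win (Bob wins or draw).
data BobHolds {n} (G : Graph n) (R : Rule n) : Player → Subset n → Subset n → Set where
  full  : ∀ {p VA VB} → (∀ v → ¬ Unclaimed VA VB v) → BobHolds G R p VA VB
  aTurn : ∀ {VA VB} →
          (∀ v → Unclaimed VA VB v →
             ¬ Dominating G (VA ∪ ⁅ v ⁆) × BobHolds G R bob (VA ∪ ⁅ v ⁆) VB) →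
          BobHolds G R alice VA VB
  bTurn : ∀ {VA VB} (v : Fin n) → Unclaimed VA VB v → R VA VB v →
          (Dominating G (VB ∪ ⁅ v ⁆) ⊎ BobHolds G R alice VA (VB ∪ ⁅ v ⁆)) →
          BobHolds G R bob VA VB

IsPosition : ∀ {n} → Graph n → Subset n → Subset n → Player → Set
IsPosition G VA VB p =
  Empty (VA ∩ VB) × ToMove VA VB p × ¬ Dominating G VA × ¬ Dominating G VB

{-# OPTIONS --safe #-}
-- Whenever a strategy asks to claim x while y is still free, claim y instead
-- and from then on follow the strategy on the mirror image of the game under
-- the transposition of x and y.  Since N[x] ∖ N[V_t] ⊆ N[y] ∖ N[V_t], the
-- strategist dominates in the actual game whenever she dominates in the mirror,
-- and the opponent dominates in the mirror whenever he does in the actual game.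
-- Once y is claimed the restriction "y before x" is void.  For Bob, a strategy
-- exists at all because this finite game is determined.
module Submission where

open import Defs hiding (sym)
open import Data.Nat using (zero; suc; _≤_; _<_; _+_)
open import Data.Nat.Properties using (≤-trans; <⇒≱; +-suc; +-monoˡ-≤; +-identityʳ; m≤n+m)
open import Data.Fin using (Fin; _≟_)
open import Data.Fin.Permutation.Components using (transpose)
open import Data.Fin.Subset using (Subset; _∈_; _∉_; _∪_; ⁅_⁆; ∣_∣; _⊆_)
open import Data.Fin.Subset.Properties
  using (_∈?_; x∈p∪q⁻; x∈p∪q⁺; p⊆p∪q; x∈⁅x⁆; x∈⁅y⁆⇒x≡y; p⊂q⇒∣p∣<∣q∣; ∣p∣≤n; ∪-assoc; ∪-comm)
open import Data.Fin.Properties using (any?; all?)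
open import Data.Bool using (true)
import Data.Bool.Properties as Bool
open import Data.Product using (_×_; _,_; proj₁; proj₂; ∃)
open import Data.Sum as Sum using (_⊎_; inj₁; inj₂; [_,_]; [_,_]′)
open import Data.Unit using (tt)
open import Data.Empty using (⊥-elim)
open import Function using (_∘_; id; _⇔_; mk⇔; Equivalence)
open import Relation.Nullary using (¬_; Dec; yes; no)
open import Relation.Nullary.Decidable using (_×-dec_; _⊎-dec_; ¬?; dec-true; dec-false)
open import Relation.Binary.PropositionalEquality
  using (_≡_; _≢_; refl; sym; trans; cong; subst; module ≡-Reasoning)

open Equivalence using (to; from)

∈-∪⁅⁆ : ∀ {n} {S : Subset n} v → v ∈ S ∪ ⁅ v ⁆
∈-∪⁅⁆ v = x∈p∪q⁺ (inj₂ (x∈⁅x⁆ v))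

∈-∪⁅⁆⁻ : ∀ {n} {S : Subset n} {u} v → u ∈ S ∪ ⁅ v ⁆ → u ∈ S ⊎ u ≡ v
∈-∪⁅⁆⁻ {S = S} v = Sum.map₂ (x∈⁅y⁆⇒x≡y v) ∘ x∈p∪q⁻ S ⁅ v ⁆

∉-∪⁅⁆ : ∀ {n} {S : Subset n} {u v} → u ∉ S → u ≢ v → u ∉ S ∪ ⁅ v ⁆
∉-∪⁅⁆ u∉S u≢v = [ u∉S , u≢v ] ∘ ∈-∪⁅⁆⁻ _

∣p∣<∣p∪⁅x⁆∣ : ∀ {n} {p : Subset n} {x} → x ∉ p → ∣ p ∣ < ∣ p ∪ ⁅ x ⁆ ∣
∣p∣<∣p∪⁅x⁆∣ {x = x} x∉p = p⊂q⇒∣p∣<∣q∣ (p⊆p∪q _ , x , ∈-∪⁅⁆ x , x∉p)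

∃-or-∀ : ∀ {n} {P Q : Fin n → Set} → (∀ v → P v ⊎ Q v) → ∃ P ⊎ (∀ v → Q v)
∃-or-∀ {zero}  choice = inj₂ λ ()
∃-or-∀ {suc n} choice with choice Fin.zero | ∃-or-∀ (choice ∘ Fin.suc)
... | inj₁ p | _             = inj₁ (Fin.zero , p)
... | inj₂ _ | inj₁ (v , p)  = inj₁ (Fin.suc v , p)
... | inj₂ q | inj₂ qs       = inj₂ λ { Fin.zero → q ; (Fin.suc v) → qs v }

unclaimed? : ∀ {n} (A B : Subset n) v → Dec (Unclaimed A B v)
unclaimed? A B v = ¬? (v ∈? A) ×-dec ¬? (v ∈? B)

unclaimed⇒∉∪ : ∀ {n} {A B : Subset n} {v} → Unclaimed A B v → v ∉ A ∪ B
unclaimed⇒∉∪ {A = A} {B} (v∉A , v∉B) = [ v∉A , v∉B ] ∘ x∈p∪q⁻ A B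

module _ {n} (G : Graph n) where

  inN? : ∀ v u → Dec (InN G v u)
  inN? v u = (u ≟ v) ⊎-dec (adj G v u Bool.≟ true)

  inNS? : ∀ S u → Dec (InNS G S u)
  inNS? S u = any? λ v → (v ∈? S) ×-dec inN? v u

  dominating? : ∀ S → Dec (Dominating G S)
  dominating? S = all? (inNS? S)

  InNS-mono : ∀ {S T u} → S ⊆ T → InNS G S u → InNS G T u
  InNS-mono S⊆T (v , v∈S , u∈N[v]) = v , S⊆T v∈S , u∈N[v]

  NbhdSub-mono : ∀ {x y S T} → S ⊆ T → NbhdSub G x y S → NbhdSub G x y T
  NbhdSub-mono S⊆T sub u (u∈N[x] , u∉N[T]) =
    proj₁ (sub u (u∈N[x] , u∉N[T] ∘ InNS-mono S⊆T)) , u∉N[T]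

  NbhdSub-∪⁅⁆ : ∀ {x y S v} → NbhdSub G x y S → NbhdSub G x y (S ∪ ⁅ v ⁆)
  NbhdSub-∪⁅⁆ = NbhdSub-mono (p⊆p∪q _)

module Determinacy {n} (G : Graph n) where

  private
    claimed-after-alice : ∀ (A B : Subset n) v → (A ∪ ⁅ v ⁆) ∪ B ≡ (A ∪ B) ∪ ⁅ v ⁆
    claimed-after-alice A B v = begin
      (A ∪ ⁅ v ⁆) ∪ B   ≡⟨ ∪-assoc A ⁅ v ⁆ B ⟩
      A ∪ (⁅ v ⁆ ∪ B)   ≡⟨ cong (A ∪_) (∪-comm ⁅ v ⁆ B) ⟩
      A ∪ (B ∪ ⁅ v ⁆)   ≡⟨ ∪-assoc A B ⁅ v ⁆ ⟨
      (A ∪ B) ∪ ⁅ v ⁆   ∎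
      where open ≡-Reasoning

    spend-fuel : ∀ {S : Subset n} {v k} → n ≤ ∣ S ∣ + suc k → v ∉ S → n ≤ ∣ S ∪ ⁅ v ⁆ ∣ + k
    spend-fuel {S} {k = k} bound v∉S =
      ≤-trans (subst (n ≤_) (+-suc ∣ S ∣ k) bound) (+-monoˡ-≤ k (∣p∣<∣p∪⁅x⁆∣ v∉S))

    -- The fuel k bounds the number of moves left: n ≤ ∣ A ∪ B ∣ + k.
    determined-within : ∀ k p (A B : Subset n) → n ≤ ∣ A ∪ B ∣ + k →
                        AliceWins G Free p A B ⊎ BobHolds G Free p A B
    determined-within k p A B bound with any? (unclaimed? A B)
    ... | no none = inj₂ (full λ v uv → none (v , uv))
    determined-within zero p A B bound | yes (v , uv) =
      ⊥-elim (<⇒≱ (∣p∣<∣p∪⁅x⁆∣ (unclaimed⇒∉∪ uv))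
                  (≤-trans (∣p∣≤n ((A ∪ B) ∪ ⁅ v ⁆)) (subst (n ≤_) (+-identityʳ _) bound)))
    determined-within (suc k) alice A B bound | yes _ =
      Sum.map (λ (v , uv , outcome) → aMove v uv tt outcome) aTurn (∃-or-∀ option)
      where
      option : ∀ v →
        (Unclaimed A B v × (Dominating G (A ∪ ⁅ v ⁆) ⊎ AliceWins G Free bob (A ∪ ⁅ v ⁆) B)) ⊎
        (Unclaimed A B v → ¬ Dominating G (A ∪ ⁅ v ⁆) × BobHolds G Free bob (A ∪ ⁅ v ⁆) B)
      option v with unclaimed? A B v
      ... | no ¬uv = inj₂ (⊥-elim ∘ ¬uv)
      ... | yes uv with dominating? G (A ∪ ⁅ v ⁆)
      ...   | yes dom = inj₁ (uv , inj₁ dom)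
      ...   | no ¬dom =
        Sum.map (λ win → uv , inj₂ win) (λ hold _ → ¬dom , hold)
          (determined-within k bob (A ∪ ⁅ v ⁆) B
            (subst (λ T → n ≤ ∣ T ∣ + k) (sym (claimed-after-alice A B v))
              (spend-fuel bound (unclaimed⇒∉∪ uv))))
    determined-within (suc k) bob A B bound | yes someUnclaimed =
      Sum.swap (Sum.map (λ (v , uv , outcome) → bTurn v uv tt outcome) (bMove someUnclaimed)
                        (∃-or-∀ option))
      where
      option : ∀ v →
        (Unclaimed A B v × (Dominating G (B ∪ ⁅ v ⁆) ⊎ BobHolds G Free alice A (B ∪ ⁅ v ⁆))) ⊎
        (Unclaimed A B v → ¬ Dominating G (B ∪ ⁅ v ⁆) × AliceWins G Free alice A (B ∪ ⁅ v ⁆))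
      option v with unclaimed? A B v
      ... | no ¬uv = inj₂ (⊥-elim ∘ ¬uv)
      ... | yes uv with dominating? G (B ∪ ⁅ v ⁆)
      ...   | yes dom = inj₁ (uv , inj₁ dom)
      ...   | no ¬dom =
        Sum.swap (Sum.map (λ win _ → ¬dom , win) (λ hold → uv , inj₂ hold)
          (determined-within k alice A (B ∪ ⁅ v ⁆)
            (subst (λ T → n ≤ ∣ T ∣ + k) (∪-assoc A B ⁅ v ⁆)
              (spend-fuel bound (unclaimed⇒∉∪ uv)))))

  determined : ∀ p (A B : Subset n) → AliceWins G Free p A B ⊎ BobHolds G Free p A B
  determined p A B = determined-within n p A B (m≤n+m n _)

open Determinacy using (determined)

module Transposition {n} (x y : Fin n) where

  σ : Fin n → Fin n
  σ = transpose x y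

  data SwapView : Fin n → Set where
    at-x      : SwapView x
    at-y      : SwapView y
    elsewhere : ∀ {u} → u ≢ x → u ≢ y → SwapView u

  swapView : ∀ u → SwapView u
  swapView u with u ≟ x | u ≟ y
  ... | yes refl | _        = at-x
  ... | no _     | yes refl = at-y
  ... | no u≢x   | no u≢y   = elsewhere u≢x u≢y

  σ-x : σ x ≡ y
  σ-x rewrite dec-true (x ≟ x) refl = refl

  σ-y : σ y ≡ x
  σ-y with y ≟ x
  ... | yes refl = refl
  ... | no _ rewrite dec-true (y ≟ y) refl = refl

  σ-elsewhere : ∀ {u} → u ≢ x → u ≢ y → σ u ≡ u
  σ-elsewhere {u} u≢x u≢y rewrite dec-false (u ≟ x) u≢x | dec-false (u ≟ y) u≢y = refl

  σ-involutive : ∀ u → σ (σ u) ≡ u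
  σ-involutive u with swapView u
  ... | at-x              rewrite σ-x = σ-y
  ... | at-y              rewrite σ-y = σ-x
  ... | elsewhere u≢x u≢y rewrite σ-elsewhere u≢x u≢y = σ-elsewhere u≢x u≢y

  σ-injective : ∀ {u v} → σ u ≡ σ v → u ≡ v
  σ-injective {u} {v} eq = trans (sym (σ-involutive u)) (trans (cong σ eq) (σ-involutive v))

  Swapped : Subset n → Subset n → Set
  Swapped S S′ = ∀ u → u ∈ S ⇔ σ u ∈ S′

  swapped-sym : ∀ {S S′} → Swapped S S′ → Swapped S′ S
  swapped-sym {S} {S′} sw u = mk⇔
    (λ u∈S′ → from (sw (σ u)) (subst (_∈ S′) (sym (σ-involutive u)) u∈S′))
    (λ σu∈S → subst (_∈ S′) (σ-involutive u) (to (sw (σ u)) σu∈S))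

  swapped-refl : ∀ {S} → x ∉ S → y ∉ S → Swapped S S
  swapped-refl {S} x∉S y∉S u with swapView u
  ... | at-x = mk⇔ (⊥-elim ∘ x∉S) (⊥-elim ∘ y∉S ∘ subst (_∈ S) σ-x)
  ... | at-y = mk⇔ (⊥-elim ∘ y∉S) (⊥-elim ∘ x∉S ∘ subst (_∈ S) σ-y)
  ... | elsewhere u≢x u≢y rewrite σ-elsewhere u≢x u≢y = mk⇔ id id

  swapped-∪ : ∀ {S S′ v w} → Swapped S S′ → σ v ≡ w → Swapped (S ∪ ⁅ v ⁆) (S′ ∪ ⁅ w ⁆)
  swapped-∪ {S} {S′} {v} {w} sw σv≡w u = mk⇔ forth back
    where
    forth : u ∈ S ∪ ⁅ v ⁆ → σ u ∈ S′ ∪ ⁅ w ⁆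
    forth u∈ with ∈-∪⁅⁆⁻ v u∈
    ... | inj₁ u∈S  = p⊆p∪q _ (to (sw u) u∈S)
    ... | inj₂ refl = subst (_∈ S′ ∪ ⁅ w ⁆) (sym σv≡w) (∈-∪⁅⁆ w)
    back : σ u ∈ S′ ∪ ⁅ w ⁆ → u ∈ S ∪ ⁅ v ⁆
    back σu∈ with ∈-∪⁅⁆⁻ w σu∈
    ... | inj₁ σu∈S′ = p⊆p∪q _ (from (sw u) σu∈S′)
    ... | inj₂ σu≡w  = subst (_∈ S ∪ ⁅ v ⁆) (σ-injective (trans σv≡w (sym σu≡w))) (∈-∪⁅⁆ v)

  unclaimed-swapped : ∀ {A B A′ B′ v} → Swapped A A′ → Swapped B B′ →
                      Unclaimed A B v → Unclaimed A′ B′ (σ v)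
  unclaimed-swapped {v = v} swA swB (v∉A , v∉B) = v∉A ∘ from (swA v) , v∉B ∘ from (swB v)

module _ {n} (G : Graph n) (x y : Fin n) where

  open Transposition x y

  dominating-swapped : ∀ {D E} → Swapped D E → (y ∈ D → y ∈ E) → NbhdSub G x y E →
                       Dominating G D → Dominating G E
  dominating-swapped {D} {E} sw y∈E⁺ sub dom u with dom u
  ... | w , w∈D , u∈N[w] with swapView w
  ...   | at-y              = y , y∈E⁺ w∈D , u∈N[w]
  ...   | elsewhere w≢x w≢y = w , subst (_∈ E) (σ-elsewhere w≢x w≢y) (to (sw w) w∈D) , u∈N[w]
  ...   | at-x with inNS? G E u
  ...     | yes u∈N[E] = u∈N[E]
  ...     | no u∉N[E]  =
    y , subst (_∈ E) σ-x (to (sw x) w∈D) , proj₁ (sub u (u∈N[w] , u∉N[E]))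

  -- The actual play (A, B) is mirrored by the strategy's play (A′, B′); as y ∈ A,
  -- the restriction "y before x" never binds.
  aliceWins-swapped : ∀ {p A B A′ B′} → Swapped A A′ → Swapped B B′ → y ∈ A → y ∉ B →
                      NbhdSub G x y A → NbhdSub G x y B′ →
                      AliceWins G Free p A′ B′ → AliceWins G (YBeforeX x y) p A B
  aliceWins-swapped {A = A} {B} {A′} {B′} swA swB y∈A y∉B subA subB′ (aMove v′ uv′ _ next) =
    aMove (σ v′) (unclaimed-swapped (swapped-sym swA) (swapped-sym swB) uv′)
          (λ (_ , (y∉A , _)) → y∉A y∈A) (continue next)
    where
    swA⁺ : Swapped (A′ ∪ ⁅ v′ ⁆) (A ∪ ⁅ σ v′ ⁆)
    swA⁺ = swapped-∪ (swapped-sym swA) refl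
    subA⁺ : NbhdSub G x y (A ∪ ⁅ σ v′ ⁆)
    subA⁺ = NbhdSub-∪⁅⁆ G subA
    continue : Dominating G (A′ ∪ ⁅ v′ ⁆) ⊎ AliceWins G Free bob (A′ ∪ ⁅ v′ ⁆) B′ →
               Dominating G (A ∪ ⁅ σ v′ ⁆) ⊎ AliceWins G (YBeforeX x y) bob (A ∪ ⁅ σ v′ ⁆) B
    continue (inj₁ dom) = inj₁ (dominating-swapped swA⁺ (λ _ → p⊆p∪q _ y∈A) subA⁺ dom)
    continue (inj₂ win) =
      inj₂ (aliceWins-swapped (swapped-sym swA⁺) swB (p⊆p∪q _ y∈A) y∉B subA⁺ subB′ win)
  aliceWins-swapped {A = A} {B} {A′} {B′} swA swB y∈A y∉B subA subB′ (bMove (v′ , uv′) reply) =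
    bMove (σ v′ , unclaimed-swapped (swapped-sym swA) (swapped-sym swB) uv′) answer
    where
    answer : ∀ v → Unclaimed A B v →
             ¬ Dominating G (B ∪ ⁅ v ⁆) × AliceWins G (YBeforeX x y) alice A (B ∪ ⁅ v ⁆)
    answer v uv =
      proj₁ (reply (σ v) uσv) ∘ dominating-swapped swB⁺ (⊥-elim ∘ y∉B⁺) subB′⁺ ,
      aliceWins-swapped swA swB⁺ y∈A y∉B⁺ subA subB′⁺ (proj₂ (reply (σ v) uσv))
      where
      uσv : Unclaimed A′ B′ (σ v)
      uσv = unclaimed-swapped swA swB uv
      swB⁺ : Swapped (B ∪ ⁅ v ⁆) (B′ ∪ ⁅ σ v ⁆)
      swB⁺ = swapped-∪ swB refl
      y∉B⁺ : y ∉ B ∪ ⁅ v ⁆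
      y∉B⁺ = ∉-∪⁅⁆ y∉B λ { refl → proj₁ uv y∈A }
      subB′⁺ : NbhdSub G x y (B′ ∪ ⁅ σ v ⁆)
      subB′⁺ = NbhdSub-∪⁅⁆ G subB′

  bobHolds-swapped : ∀ {p A B A′ B′} → Swapped A A′ → Swapped B B′ → y ∈ B → y ∉ A →
                     NbhdSub G x y B → NbhdSub G x y A′ →
                     BobHolds G Free p A′ B′ → BobHolds G (YBeforeX x y) p A B
  bobHolds-swapped swA swB y∈B y∉A subB subA′ (full none) =
    full λ v uv → none (σ v) (unclaimed-swapped swA swB uv)
  bobHolds-swapped {A = A} {B} {A′} {B′} swA swB y∈B y∉A subB subA′ (aTurn reply) =
    aTurn answer
    where
    answer : ∀ v → Unclaimed A B v →
             ¬ Dominating G (A ∪ ⁅ v ⁆) × BobHolds G (YBeforeX x y) bob (A ∪ ⁅ v ⁆) B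
    answer v uv =
      proj₁ (reply (σ v) uσv) ∘ dominating-swapped swA⁺ (⊥-elim ∘ y∉A⁺) subA′⁺ ,
      bobHolds-swapped swA⁺ swB y∈B y∉A⁺ subB subA′⁺ (proj₂ (reply (σ v) uσv))
      where
      uσv : Unclaimed A′ B′ (σ v)
      uσv = unclaimed-swapped swA swB uv
      swA⁺ : Swapped (A ∪ ⁅ v ⁆) (A′ ∪ ⁅ σ v ⁆)
      swA⁺ = swapped-∪ swA refl
      y∉A⁺ : y ∉ A ∪ ⁅ v ⁆
      y∉A⁺ = ∉-∪⁅⁆ y∉A λ { refl → proj₂ uv y∈B }
      subA′⁺ : NbhdSub G x y (A′ ∪ ⁅ σ v ⁆)
      subA′⁺ = NbhdSub-∪⁅⁆ G subA′
  bobHolds-swapped {A = A} {B} {A′} {B′} swA swB y∈B y∉A subB subA′ (bTurn v′ uv′ _ next) =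
    bTurn (σ v′) (unclaimed-swapped (swapped-sym swA) (swapped-sym swB) uv′)
          (λ (_ , (_ , y∉B)) → y∉B y∈B) (continue next)
    where
    swB⁺ : Swapped (B′ ∪ ⁅ v′ ⁆) (B ∪ ⁅ σ v′ ⁆)
    swB⁺ = swapped-∪ (swapped-sym swB) refl
    subB⁺ : NbhdSub G x y (B ∪ ⁅ σ v′ ⁆)
    subB⁺ = NbhdSub-∪⁅⁆ G subB
    continue : Dominating G (B′ ∪ ⁅ v′ ⁆) ⊎ BobHolds G Free alice A′ (B′ ∪ ⁅ v′ ⁆) →
               Dominating G (B ∪ ⁅ σ v′ ⁆) ⊎ BobHolds G (YBeforeX x y) alice A (B ∪ ⁅ σ v′ ⁆)
    continue (inj₁ dom)  = inj₁ (dominating-swapped swB⁺ (λ _ → p⊆p∪q _ y∈B) subB⁺ dom)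
    continue (inj₂ hold) =
      inj₂ (bobHolds-swapped swA (swapped-sym swB⁺) (p⊆p∪q _ y∈B) y∉A subB⁺ subA′ hold)

module _ {n} (G : Graph n) {x y : Fin n} (x≢y : x ≢ y) where

  open Transposition x y

  aliceWins-restrict : ∀ {p A B} → NbhdSub G x y A → NbhdSub G x y B →
                       AliceWins G Free p A B → AliceWins G (YBeforeX x y) p A B
  aliceWins-restrict {A = A} {B} subA subB (aMove v uv _ next)
    with (v ≟ x) ×-dec unclaimed? A B y
  ... | no allowed = aMove v uv allowed (continue next)
    where
    continue : Dominating G (A ∪ ⁅ v ⁆) ⊎ AliceWins G Free bob (A ∪ ⁅ v ⁆) B →
               Dominating G (A ∪ ⁅ v ⁆) ⊎ AliceWins G (YBeforeX x y) bob (A ∪ ⁅ v ⁆) B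
    continue (inj₁ dom) = inj₁ dom
    continue (inj₂ win) = inj₂ (aliceWins-restrict (NbhdSub-∪⁅⁆ G subA) subB win)
  ... | yes (refl , uy) = aMove y uy (λ (y≡x , _) → x≢y (sym y≡x)) (claim-y-instead next)
    where
    swA : Swapped (A ∪ ⁅ y ⁆) (A ∪ ⁅ x ⁆)
    swA = swapped-∪ (swapped-refl (proj₁ uv) (proj₁ uy)) σ-y
    subA⁺ : NbhdSub G x y (A ∪ ⁅ y ⁆)
    subA⁺ = NbhdSub-∪⁅⁆ G subA
    claim-y-instead : Dominating G (A ∪ ⁅ x ⁆) ⊎ AliceWins G Free bob (A ∪ ⁅ x ⁆) B →
                      Dominating G (A ∪ ⁅ y ⁆) ⊎ AliceWins G (YBeforeX x y) bob (A ∪ ⁅ y ⁆) B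
    claim-y-instead (inj₁ dom) =
      inj₁ (dominating-swapped G x y (swapped-sym swA) (λ _ → ∈-∪⁅⁆ y) subA⁺ dom)
    claim-y-instead (inj₂ win) =
      inj₂ (aliceWins-swapped G x y swA (swapped-refl (proj₂ uv) (proj₂ uy))
                              (∈-∪⁅⁆ y) (proj₂ uy) subA⁺ subB win)
  aliceWins-restrict subA subB (bMove someUnclaimed reply) =
    bMove someUnclaimed λ v uv →
      proj₁ (reply v uv) , aliceWins-restrict subA (NbhdSub-∪⁅⁆ G subB) (proj₂ (reply v uv))

  bobHolds-restrict : ∀ {p A B} → NbhdSub G x y A → NbhdSub G x y B →
                      BobHolds G Free p A B → BobHolds G (YBeforeX x y) p A B
  bobHolds-restrict subA subB (full none) = full none
  bobHolds-restrict subA subB (aTurn reply) =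
    aTurn λ v uv →
      proj₁ (reply v uv) , bobHolds-restrict (NbhdSub-∪⁅⁆ G subA) subB (proj₂ (reply v uv))
  bobHolds-restrict {A = A} {B} subA subB (bTurn v uv _ next)
    with (v ≟ x) ×-dec unclaimed? A B y
  ... | no allowed = bTurn v uv allowed (continue next)
    where
    continue : Dominating G (B ∪ ⁅ v ⁆) ⊎ BobHolds G Free alice A (B ∪ ⁅ v ⁆) →
               Dominating G (B ∪ ⁅ v ⁆) ⊎ BobHolds G (YBeforeX x y) alice A (B ∪ ⁅ v ⁆)
    continue (inj₁ dom)  = inj₁ dom
    continue (inj₂ hold) = inj₂ (bobHolds-restrict subA (NbhdSub-∪⁅⁆ G subB) hold)
  ... | yes (refl , uy) = bTurn y uy (λ (y≡x , _) → x≢y (sym y≡x)) (claim-y-instead next)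
    where
    swB : Swapped (B ∪ ⁅ y ⁆) (B ∪ ⁅ x ⁆)
    swB = swapped-∪ (swapped-refl (proj₂ uv) (proj₂ uy)) σ-y
    subB⁺ : NbhdSub G x y (B ∪ ⁅ y ⁆)
    subB⁺ = NbhdSub-∪⁅⁆ G subB
    claim-y-instead : Dominating G (B ∪ ⁅ x ⁆) ⊎ BobHolds G Free alice A (B ∪ ⁅ x ⁆) →
                      Dominating G (B ∪ ⁅ y ⁆) ⊎ BobHolds G (YBeforeX x y) alice A (B ∪ ⁅ y ⁆)
    claim-y-instead (inj₁ dom) =
      inj₁ (dominating-swapped G x y (swapped-sym swB) (λ _ → ∈-∪⁅⁆ y) subB⁺ dom)
    claim-y-instead (inj₂ hold) =
      inj₂ (bobHolds-swapped G x y (swapped-refl (proj₁ uv) (proj₁ uy)) swB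
                             (∈-∪⁅⁆ y) (proj₁ uy) subB⁺ subA hold)

lemma1 : ∀ {n} (G : Graph n) (VA VB : Subset n) (p : Player) (x y : Fin n) →
    IsPosition G VA VB p →
    x ≢ y → Unclaimed VA VB x → Unclaimed VA VB y →
    NbhdSub G x y VA → NbhdSub G x y VB →
    (AliceWins G Free p VA VB → AliceWins G (YBeforeX x y) p VA VB) ×
    (¬ AliceWins G Free p VA VB → BobHolds G (YBeforeX x y) p VA VB)
lemma1 G VA VB p x y _ x≢y _ _ subA subB =
  aliceWins-restrict G x≢y subA subB ,
  λ ¬win → bobHolds-restrict G x≢y subA subB ([ ⊥-elim ∘ ¬win , id ]′ (determined G p VA VB))
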